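{- Let $t\ge2$ be an integer. For every positive integer $n$, $\operatorname{ldim}_t(\mathbf{n})=\lceil \log_t n\rceil$, where $\mathbf{n}$ is the $n$-element chain.
   Context: For an integer $m\ge1$, $\mathbf{m}$ denotes the $m$-element chain. A partial function $f$ from a poset $P$ to a chain is monotone if $x\le y$ with $x,y\in\operatorname{dom}(f)$ implies $f(x)\le f(y)$. A local $t$-realiser of $P$ is a set $\mathcal{R}$ of monotone partial functions from $P$ to $\mathbf{t}$ such that for all $x,y\in P$ with $x\not\ge y$ there is $f\in\mathcal{R}$ with $x,y\in\operatorname{dom}(f)$ and $f(x)<f(y)$. The multiplicity $\mu_{\mathcal{R}}(x)$ is the number of $f\in\mathcal{R}$ with $x\in\operatorname{dom}(f)$. The local $t$-dimension $\operatorname{ldim}_t(P)$ is the minimum over all local $t$-realisers $\mathcal{R}$ of $P$ of $\max\{\mu_{\mathcal{R}}(x): x\in P\}$. -}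

module Defs where

open import Level using (Level)
open import Data.Nat using (ℕ; _≤_; _^_)
open import Data.Fin using (Fin)
import Data.Fin as Fin
open import Data.Fin.Properties using (≤-poset)
open import Data.Maybe using (Maybe; just; is-just)
open import Data.List using (List; length; filterᵇ)
open import Data.List.Membership.Propositional using (_∈_)
open import Data.Product using (Σ; ∃; _×_; _,_)
open import Relation.Binary.Bundles using (Poset)
open import Relation.Binary.PropositionalEquality using (_≡_)
open import Relation.Nullary using (¬_)

chain : ℕ → Poset _ _ _
chain m = ≤-poset m

module _ {c ℓ₁ ℓ₂ : Level} (P : Poset c ℓ₁ ℓ₂) (t : ℕ) where
  private
    X = Poset.Carrier P
    _⊑_ = Poset._≤_ P

  PartialFun : Set c
  PartialFun = X → Maybe (Fin t)

  Monotone : PartialFun → Set _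
  Monotone f = ∀ {x y a b} → x ⊑ y → f x ≡ just a → f y ≡ just b → a Fin.≤ b

  IsLocalRealiser : List PartialFun → Set _
  IsLocalRealiser R =
    (∀ {f} → f ∈ R → Monotone f) ×
    (∀ x y → ¬ (y ⊑ x) →
      ∃ λ f → f ∈ R × Σ (Fin t) λ a → Σ (Fin t) λ b →
        f x ≡ just a × f y ≡ just b × a Fin.< b)

  multiplicity : List PartialFun → X → ℕ
  multiplicity R x = length (filterᵇ (λ f → is-just (f x)) R)

  MaxMultiplicity≤ : List PartialFun → ℕ → Set _
  MaxMultiplicity≤ R k = ∀ x → multiplicity R x ≤ k

  LDim≡ : ℕ → Set _
  LDim≡ k =
    (Σ (List PartialFun) λ R → IsLocalRealiser R × MaxMultiplicity≤ R k) ×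
    (∀ R → IsLocalRealiser R → ∀ j → MaxMultiplicity≤ R j → k ≤ j)

IsCeilLog : ℕ → ℕ → ℕ → Set
IsCeilLog t n k = n ≤ t ^ k × (∀ j → n ≤ t ^ j → k ≤ j)

-- Lower bound: a Kraft-type inequality. If any two distinct points are separated by
-- maps of R (both defined, with different values) and every point x lies in at most J
-- domains, then ∑ₓ t ^ (J − μ x) ≤ t ^ J, so n ≤ t ^ J. By induction on R: split the
-- points into t overlapping parts according to the value of the first map f (a point
-- outside dom f goes to every part). The rest of R separates each part, and a point in
-- dom f lies in only one part but its weight there is multiplied by t, as it has one
-- domain fewer.
--
-- Upper bound: if n ≤ t ^ k, write the points in base t with k digits. For a position i
-- and a value p of the digits above i, reading digit i on the block of points whose
-- higher digits spell p is monotone. Every point lies in one block per position, hence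
-- in k domains, and two points are separated at their highest differing digit.
module Submission where

open import Data.Bool using (Bool; true; false; if_then_else_; _∧_; T)
open import Data.Empty using (⊥-elim)
open import Data.Fin as Fin using (Fin; toℕ; zero; suc)
import Data.Fin.Properties as Finₚ
open import Data.List using (List; []; _∷_; _++_)
open import Data.List.Membership.Propositional using (_∈_)
open import Data.List.Membership.Propositional.Properties using (∈-++⁺ˡ; ∈-++⁺ʳ; ∈-++⁻)
open import Data.List.Relation.Unary.Any using (here; there)
open import Data.Maybe using (Maybe; just; nothing; when)
open import Data.Nat
  using (ℕ; zero; suc; _+_; _*_; _∸_; _^_; _≤_; _<_; z≤n; s≤s; z<s; NonZero; >-nonZero; _/_)
open import Data.Nat.DivMod
open import Data.Nat.Properties
open import Algebra.Properties.Semiring.Sum +-*-semiring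
  using (sum; sum-syntax; sum-cong-≗; ∑-comm; *-distribˡ-sum)
open import Data.Product using (∃; ∃₂; _×_; _,_)
open import Data.Sum using (inj₁; inj₂)
open import Function using (_∘_)
open import Relation.Binary.Definitions using (tri<; tri≈; tri>)
open import Relation.Binary.PropositionalEquality
open import Relation.Nullary using (¬_; Dec; yes; no; does; contradiction)
open import Relation.Nullary.Decidable using (dec-true; dec-false)

open import Defs

variable
  m n t : ℕ

sum-mono-≤ : {f g : Fin m → ℕ} → (∀ i → f i ≤ g i) → sum f ≤ sum g
sum-mono-≤ {zero}  f≤g = z≤n
sum-mono-≤ {suc m} f≤g = +-mono-≤ (f≤g zero) (sum-mono-≤ (f≤g ∘ suc))

sum-const : ∀ m c → ∑[ _ < m ] c ≡ m * c
sum-const zero    c = refl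
sum-const (suc m) c = cong (c +_) (sum-const m c)

≤-sum : (f : Fin m → ℕ) (i : Fin m) → f i ≤ sum f
≤-sum f zero    = m≤m+n _ _
≤-sum f (suc i) = ≤-trans (≤-sum (f ∘ suc) i) (m≤n+m _ _)

sum-≤-subsingletonSupport : ∀ {c} (f : Fin m → ℕ) → (∀ i → f i ≤ c) →
  (∀ i j → f i ≢ 0 → f j ≢ 0 → i ≡ j) → sum f ≤ c
sum-≤-subsingletonSupport {zero}  f _   _      = z≤n
sum-≤-subsingletonSupport {suc m} {c} f f≤c unique with f zero ≟ 0
... | yes f₀≡0 = begin
  f zero + sum (f ∘ suc) ≡⟨ cong (_+ sum (f ∘ suc)) f₀≡0 ⟩
  sum (f ∘ suc)          ≤⟨ sum-≤-subsingletonSupport (f ∘ suc) (f≤c ∘ suc)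
                              (λ i j fᵢ≢0 fⱼ≢0 → Finₚ.suc-injective (unique _ _ fᵢ≢0 fⱼ≢0)) ⟩
  c                      ∎
  where open ≤-Reasoning
... | no f₀≢0 = begin
  f zero + sum (f ∘ suc)   ≡⟨ cong (f zero +_) (sum-cong-≗ tail≡0) ⟩
  f zero + ∑[ _ < m ] 0    ≡⟨ cong (f zero +_) (trans (sum-const m 0) (*-zeroʳ m)) ⟩
  f zero + 0               ≡⟨ +-identityʳ (f zero) ⟩
  f zero                   ≤⟨ f≤c zero ⟩
  c                        ∎
  where
  open ≤-Reasoning
  tail≡0 : ∀ i → f (suc i) ≡ 0
  tail≡0 i with f (suc i) ≟ 0
  ... | yes fᵢ≡0 = fᵢ≡0
  ... | no  fᵢ≢0 = contradiction (unique zero (suc i) f₀≢0 fᵢ≢0) λ ()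

when-does-just : ∀ {P A : Set} (P? : Dec P) {c a : A} → when (does P?) c ≡ just a → P × c ≡ a
when-does-just (yes p) refl = p , refl

Map : ℕ → ℕ → Set
Map n t = PartialFun (chain n) t

μ : List (Map n t) → Fin n → ℕ
μ {n = n} {t = t} = multiplicity (chain n) t

μ-∷-just : ∀ (f : Map n t) R x {a} → f x ≡ just a → μ (f ∷ R) x ≡ suc (μ R x)
μ-∷-just f R x fx≡a rewrite fx≡a = refl

μ-∷-nothing : ∀ (f : Map n t) R x → f x ≡ nothing → μ (f ∷ R) x ≡ μ R x
μ-∷-nothing f R x fx≡nothing rewrite fx≡nothing = refl

μ-∷-≤ : ∀ (f : Map n t) R x → μ R x ≤ μ (f ∷ R) x
μ-∷-≤ f R x with f x
... | just _  = n≤1+n _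
... | nothing = ≤-refl

μ-++ : ∀ (R R′ : List (Map n t)) x → μ (R ++ R′) x ≡ μ R x + μ R′ x
μ-++ []      R′ x = refl
μ-++ (f ∷ R) R′ x with f x
... | just _  = cong suc (μ-++ R R′ x)
... | nothing = μ-++ R R′ x

Separated : List (Map n t) → Fin n → Fin n → Set
Separated R x y = ∃ λ f → f ∈ R × ∃₂ λ a b → f x ≡ just a × f y ≡ just b × a ≢ b

IsSeparating : List (Map n t) → (Fin n → Bool) → Set
IsSeparating R S = ∀ {x y} → T (S x) → T (S y) → x ≢ y → Separated R x y

compatible : Fin t → Maybe (Fin t) → Bool
compatible v nothing  = true
compatible v (just a) = does (a Fin.≟ v)

restrict : Map n t → Fin t → (Fin n → Bool) → Fin n → Bool
restrict f v S x = S x ∧ compatible v (f x)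

restrict-⊆ : ∀ (f : Map n t) v S {x} → T (restrict f v S x) → T (S x)
restrict-⊆ f v S {x} x∈ with S x
... | true = _

restrict-value : ∀ (f : Map n t) v S {x a} → T (restrict f v S x) → f x ≡ just a → a ≡ v
restrict-value f v S {x} x∈ fx≡a with S x | f x
restrict-value f v S x∈ refl | true | just a with a Fin.≟ v
... | yes a≡v = a≡v

restrict-separating : ∀ {f : Map n t} {R S} v → IsSeparating (f ∷ R) S → IsSeparating R (restrict f v S)
restrict-separating {f = f} {S = S} v sep x∈ y∈ x≢y
  with sep (restrict-⊆ f v S x∈) (restrict-⊆ f v S y∈) x≢y
... | g , there g∈R , rest = g , g∈R , rest
... | _ , here refl , a , b , fx≡a , fy≡b , a≢b =
  ⊥-elim (a≢b (trans (restrict-value f v S x∈ fx≡a) (sym (restrict-value f v S y∈ fy≡b))))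

module Kraft {n t : ℕ} .{{_ : NonZero t}} where

  contribution : ℕ → List (Map n t) → (Fin n → Bool) → Fin n → ℕ
  contribution J R S x = if S x then t ^ (J ∸ μ R x) else 0

  weight : ℕ → List (Map n t) → (Fin n → Bool) → ℕ
  weight J R S = ∑[ x < n ] contribution J R S x

  ^-∸-suc : ∀ {J k} → suc k ≤ J → t * t ^ (J ∸ suc k) ≡ t ^ (J ∸ k)
  ^-∸-suc sk≤J = cong (t ^_) (sym (+-∸-assoc 1 sk≤J))

  contribution-split : ∀ J (f : Map n t) R S x → (T (S x) → μ (f ∷ R) x ≤ J) →
    t * contribution J (f ∷ R) S x ≤ ∑[ v < t ] contribution J R (restrict f v S) x
  contribution-split J f R S x μ≤J with S x
  ... | false = ≤-trans (≤-reflexive (*-zeroʳ t)) z≤n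
  ... | true  = split (f x) refl
    where
    c : ℕ
    c = t ^ (J ∸ μ R x)
    term : Maybe (Fin t) → Fin t → ℕ
    term o v = if compatible v o then c else 0
    split : ∀ o → f x ≡ o → t * t ^ (J ∸ μ (f ∷ R) x) ≤ ∑[ v < t ] term (f x) v
    split nothing fx = ≤-reflexive (begin
      t * t ^ (J ∸ μ (f ∷ R) x) ≡⟨ cong (λ k → t * t ^ (J ∸ k)) (μ-∷-nothing f R x fx) ⟩
      t * c                     ≡⟨ sum-const t c ⟨
      ∑[ v < t ] term nothing v ≡⟨ sum-cong-≗ (λ v → cong (λ o → term o v) fx) ⟨
      ∑[ v < t ] term (f x) v   ∎)
      where open ≡-Reasoning
    split (just w) fx = begin
      t * t ^ (J ∸ μ (f ∷ R) x)  ≡⟨ cong (λ k → t * t ^ (J ∸ k)) μ≡ ⟩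
      t * t ^ (J ∸ suc (μ R x))  ≡⟨ ^-∸-suc (subst (_≤ J) μ≡ (μ≤J _)) ⟩
      c                          ≡⟨ cong (if_then c else 0) (dec-true (w Fin.≟ w) refl) ⟨
      term (just w) w            ≡⟨ cong (λ o → term o w) fx ⟨
      term (f x) w               ≤⟨ ≤-sum (term (f x)) w ⟩
      ∑[ v < t ] term (f x) v    ∎
      where
      open ≤-Reasoning
      μ≡ : μ (f ∷ R) x ≡ suc (μ R x)
      μ≡ = μ-∷-just f R x fx

  -- The bound μ R x ≤ J keeps J ∸ μ R x from truncating.
  kraft : ∀ J R S → IsSeparating R S → (∀ x → T (S x) → μ R x ≤ J) → weight J R S ≤ t ^ J
  kraft J [] S sep _ = sum-≤-subsingletonSupport (contribution J [] S) bounded unique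
    where
    bounded : ∀ x → contribution J [] S x ≤ t ^ J
    bounded x with S x
    ... | true  = ≤-refl
    ... | false = z≤n
    member : ∀ x → contribution J [] S x ≢ 0 → T (S x)
    member x c≢0 with S x
    ... | true  = _
    ... | false = c≢0 refl
    unique : ∀ x y → contribution J [] S x ≢ 0 → contribution J [] S y ≢ 0 → x ≡ y
    unique x y cx≢0 cy≢0 with x Fin.≟ y
    ... | yes x≡y = x≡y
    ... | no  x≢y with sep (member x cx≢0) (member y cy≢0) x≢y
    ...   | _ , () , _
  kraft J (f ∷ R) S sep μ≤J = *-cancelˡ-≤ t (begin
    t * weight J (f ∷ R) S                                   ≡⟨ *-distribˡ-sum t (contribution J (f ∷ R) S) ⟩
    ∑[ x < n ] (t * contribution J (f ∷ R) S x)              ≤⟨ sum-mono-≤ split ⟩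
    ∑[ x < n ] (∑[ v < t ] contribution J R (restrict f v S) x) ≡⟨ ∑-comm (λ x v → contribution J R (restrict f v S) x) ⟩
    ∑[ v < t ] weight J R (restrict f v S)                    ≤⟨ sum-mono-≤ recurse ⟩
    ∑[ v < t ] (t ^ J)                                        ≡⟨ sum-const t (t ^ J) ⟩
    t * t ^ J                                                 ∎)
    where
    open ≤-Reasoning
    split : ∀ x → t * contribution J (f ∷ R) S x ≤ ∑[ v < t ] contribution J R (restrict f v S) x
    split x = contribution-split J f R S x (μ≤J x)
    recurse : ∀ v → weight J R (restrict f v S) ≤ t ^ J
    recurse v = kraft J R (restrict f v S) (restrict-separating v sep)
      (λ x x∈ → ≤-trans (μ-∷-≤ f R x) (μ≤J x (restrict-⊆ f v S x∈)))

  separating⇒≤^ : ∀ J R → IsSeparating R (λ _ → true) → (∀ x → μ R x ≤ J) → n ≤ t ^ J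
  separating⇒≤^ J R sep μ≤J = begin
    n                        ≡⟨ trans (sum-const n 1) (*-identityʳ n) ⟨
    ∑[ x < n ] 1             ≤⟨ sum-mono-≤ (λ x → m^n>0 t (J ∸ μ R x)) ⟩
    weight J R (λ _ → true)  ≤⟨ kraft J R _ sep (λ x _ → μ≤J x) ⟩
    t ^ J                    ∎
    where open ≤-Reasoning

realiser-separating : ∀ {R} → IsLocalRealiser (chain n) t R → IsSeparating R (λ _ → true)
realiser-separating (_ , sep) {x} {y} _ _ x≢y with Finₚ.<-cmp x y
... | tri< x<y _ _ with sep x y (<⇒≱ x<y)
...   | f , f∈R , a , b , fx≡a , fy≡b , a<b = f , f∈R , a , b , fx≡a , fy≡b , Finₚ.<⇒≢ a<b
realiser-separating _ _ _ x≢y | tri≈ _ x≡y _ = ⊥-elim (x≢y x≡y)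
realiser-separating (_ , sep) {x} {y} _ _ _ | tri> _ _ y<x with sep y x (<⇒≱ y<x)
...   | f , f∈R , a , b , fy≡a , fx≡b , a<b = f , f∈R , b , a , fx≡b , fy≡a , Finₚ.<⇒≢ a<b ∘ sym

realiser⇒≤^ : .{{_ : NonZero t}} → ∀ {R j} → IsLocalRealiser (chain n) t R →
  MaxMultiplicity≤ (chain n) t R j → n ≤ t ^ j
realiser⇒≤^ {R = R} {j} isRealiser = Kraft.separating⇒≤^ j R (realiser-separating isRealiser)

module Digits (t : ℕ) .{{_ : NonZero t}} where

  dropDigits : ℕ → ℕ → ℕ
  dropDigits zero    x = x
  dropDigits (suc i) x = dropDigits i (x / t)

  digit : ℕ → ℕ → Fin t
  digit i x = dropDigits i x mod t

  dropDigits-suc : ∀ i x → dropDigits (suc i) x ≡ dropDigits i x / t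
  dropDigits-suc zero    x = refl
  dropDigits-suc (suc i) x = dropDigits-suc i (x / t)

  dropDigits-mono-≤ : ∀ i {x y} → x ≤ y → dropDigits i x ≤ dropDigits i y
  dropDigits-mono-≤ zero    x≤y = x≤y
  dropDigits-mono-≤ (suc i) x≤y = dropDigits-mono-≤ i (/-monoˡ-≤ t x≤y)

  dropDigits-≤ : ∀ i x → dropDigits i x ≤ x
  dropDigits-≤ zero    x = ≤-refl
  dropDigits-≤ (suc i) x = ≤-trans (dropDigits-≤ i (x / t)) (m/n≤m x t)

  toℕ-mod+quotient : ∀ u {q} → u / t ≡ q → toℕ (u mod t) + q * t ≡ u
  toℕ-mod+quotient u refl = sym (DivMod.property (u divMod t))

  mod-mono-≤ : ∀ {u v} → u / t ≡ v / t → u ≤ v → u mod t Fin.≤ v mod t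
  mod-mono-≤ {u} {v} u/t≡v/t u≤v = +-cancelʳ-≤ (v / t * t) _ _
    (subst₂ _≤_ (sym (toℕ-mod+quotient u u/t≡v/t)) (sym (toℕ-mod+quotient v refl)) u≤v)

  mod-mono-< : ∀ {u v} → u / t ≡ v / t → u < v → u mod t Fin.< v mod t
  mod-mono-< {u} {v} u/t≡v/t u<v = +-cancelʳ-< (v / t * t) _ _
    (subst₂ _<_ (sym (toℕ-mod+quotient u u/t≡v/t)) (sym (toℕ-mod+quotient v refl)) u<v)

  highestDifferingDigit : ∀ k {x y} → x < y → y < t ^ k →
    ∃ λ i → i < k × dropDigits (suc i) x ≡ dropDigits (suc i) y × digit i x Fin.< digit i y
  highestDifferingDigit zero {y = zero}  ()  _
  highestDifferingDigit zero {y = suc _} _   (s≤s ())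
  highestDifferingDigit (suc k) {x} {y} x<y y<t^k with <-cmp (x / t) (y / t)
  ... | tri≈ _ x/t≡y/t _ = 0 , z<s , x/t≡y/t , mod-mono-< x/t≡y/t x<y
  ... | tri> _ _ y/t<x/t = contradiction (/-monoˡ-≤ t (<⇒≤ x<y)) (<⇒≱ y/t<x/t)
  ... | tri< x/t<y/t _ _
    with highestDifferingDigit k x/t<y/t (m<n*o⇒m/o<n (subst (y <_) (*-comm t (t ^ k)) y<t^k))
  ...   | i , i<k , same , differ = suc i , s≤s i<k , same , differ

  blockDigit : ℕ → ℕ → Map n t
  blockDigit i p x = when (does (dropDigits (suc i) (toℕ x) ≟ p)) (digit i (toℕ x))

  blockDigit-just : ∀ i p (x : Fin n) {a} → blockDigit i p x ≡ just a →
    dropDigits (suc i) (toℕ x) ≡ p × digit i (toℕ x) ≡ a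
  blockDigit-just i p x = when-does-just (dropDigits (suc i) (toℕ x) ≟ p)

  blockDigit-inBlock : ∀ i (x : Fin n) →
    blockDigit i (dropDigits (suc i) (toℕ x)) x ≡ just (digit i (toℕ x))
  blockDigit-inBlock i x =
    cong (λ b → when b (digit i (toℕ x))) (dec-true (dropDigits (suc i) (toℕ x) ≟ _) refl)

  blockDigit-outside : ∀ i p (x : Fin n) → dropDigits (suc i) (toℕ x) ≢ p →
    blockDigit i p x ≡ nothing
  blockDigit-outside i p x outside = cong (λ b → when b (digit i (toℕ x))) (dec-false (_ ≟ p) outside)

  blockDigit-monotone : ∀ i p → Monotone (chain n) t (blockDigit i p)
  blockDigit-monotone i p {x} {y} x≤y fx≡a fy≡b
    with blockDigit-just i p x fx≡a | blockDigit-just i p y fy≡b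
  ... | x∈p , refl | y∈p , refl = mod-mono-≤ sameQuotient (dropDigits-mono-≤ i x≤y)
    where
    sameQuotient : dropDigits i (toℕ x) / t ≡ dropDigits i (toℕ y) / t
    sameQuotient = begin
      dropDigits i (toℕ x) / t   ≡⟨ dropDigits-suc i (toℕ x) ⟨
      dropDigits (suc i) (toℕ x) ≡⟨ trans x∈p (sym y∈p) ⟩
      dropDigits (suc i) (toℕ y) ≡⟨ dropDigits-suc i (toℕ y) ⟩
      dropDigits i (toℕ y) / t   ∎
      where open ≡-Reasoning

  blockDigits : ℕ → ℕ → List (Map n t)
  blockDigits i zero    = []
  blockDigits i (suc m) = blockDigit i m ∷ blockDigits i m

  digitRealiser : ℕ → List (Map n t)
  digitRealiser zero = []
  digitRealiser {n = n} (suc k) = blockDigits k n ++ digitRealiser k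

  μ-blockDigits-≡0 : ∀ i m (x : Fin n) → m ≤ dropDigits (suc i) (toℕ x) → μ (blockDigits i m) x ≡ 0
  μ-blockDigits-≡0 i zero    x _   = refl
  μ-blockDigits-≡0 i (suc m) x m<p = begin
    μ (blockDigit i m ∷ blockDigits i m) x
      ≡⟨ μ-∷-nothing (blockDigit i m) (blockDigits i m) x (blockDigit-outside i m x (>⇒≢ m<p)) ⟩
    μ (blockDigits i m) x                  ≡⟨ μ-blockDigits-≡0 i m x (<⇒≤ m<p) ⟩
    0                                      ∎
    where open ≡-Reasoning

  μ-blockDigits-≤1 : ∀ i m (x : Fin n) → μ (blockDigits i m) x ≤ 1
  μ-blockDigits-≤1 i zero    x = z≤n
  μ-blockDigits-≤1 i (suc m) x with dropDigits (suc i) (toℕ x) ≟ m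
  ... | yes refl = ≤-reflexive (begin
    μ (blockDigit i m ∷ blockDigits i m) x
      ≡⟨ μ-∷-just (blockDigit i m) (blockDigits i m) x (blockDigit-inBlock i x) ⟩
    suc (μ (blockDigits i m) x)            ≡⟨ cong suc (μ-blockDigits-≡0 i m x ≤-refl) ⟩
    1                                      ∎)
    where open ≡-Reasoning
  ... | no outside = begin
    μ (blockDigit i m ∷ blockDigits i m) x
      ≡⟨ μ-∷-nothing (blockDigit i m) (blockDigits i m) x (blockDigit-outside i m x outside) ⟩
    μ (blockDigits i m) x                  ≤⟨ μ-blockDigits-≤1 i m x ⟩
    1                                      ∎
    where open ≤-Reasoning

  μ-digitRealiser : ∀ k (x : Fin n) → μ (digitRealiser k) x ≤ k
  μ-digitRealiser zero    x = z≤n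
  μ-digitRealiser {n = n} (suc k) x = begin
    μ (blockDigits k n ++ digitRealiser k) x       ≡⟨ μ-++ (blockDigits k n) (digitRealiser k) x ⟩
    μ (blockDigits k n) x + μ (digitRealiser k) x  ≤⟨ +-mono-≤ (μ-blockDigits-≤1 k n x) (μ-digitRealiser k x) ⟩
    suc k                                          ∎
    where open ≤-Reasoning

  blockDigits-monotone : ∀ i m {f : Map n t} → f ∈ blockDigits i m → Monotone (chain n) t f
  blockDigits-monotone i (suc m) (here refl) = blockDigit-monotone i m
  blockDigits-monotone i (suc m) (there f∈)  = blockDigits-monotone i m f∈

  digitRealiser-monotone : ∀ k {f : Map n t} → f ∈ digitRealiser k → Monotone (chain n) t f
  digitRealiser-monotone {n = n} (suc k) f∈ with ∈-++⁻ (blockDigits k n) f∈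
  ... | inj₁ f∈row  = blockDigits-monotone k n f∈row
  ... | inj₂ f∈rest = digitRealiser-monotone k f∈rest

  blockDigit-∈-blockDigits : ∀ i m p → p < m → blockDigit {n} i p ∈ blockDigits i m
  blockDigit-∈-blockDigits i (suc m) p (s≤s p≤m) with p ≟ m
  ... | yes refl = here refl
  ... | no  p≢m  = there (blockDigit-∈-blockDigits i m p (≤∧≢⇒< p≤m p≢m))

  blockDigit-∈-digitRealiser : ∀ k i p → i < k → p < n → blockDigit {n} i p ∈ digitRealiser k
  blockDigit-∈-digitRealiser {n = n} (suc k) i p (s≤s i≤k) p<n with i ≟ k
  ... | yes refl = ∈-++⁺ˡ (blockDigit-∈-blockDigits i n p p<n)
  ... | no  i≢k  = ∈-++⁺ʳ (blockDigits k n) (blockDigit-∈-digitRealiser k i p (≤∧≢⇒< i≤k i≢k) p<n)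

  digitRealiser-isLocalRealiser : ∀ k → n ≤ t ^ k → IsLocalRealiser (chain n) t (digitRealiser k)
  digitRealiser-isLocalRealiser {n = n} k n≤t^k = digitRealiser-monotone k , separates
    where
    separates : ∀ x y → ¬ (y Fin.≤ x) → ∃ λ f → f ∈ digitRealiser k ×
      ∃₂ λ a b → f x ≡ just a × f y ≡ just b × a Fin.< b
    separates x y y≰x with highestDifferingDigit k (≰⇒> y≰x) (≤-trans (Finₚ.toℕ<n y) n≤t^k)
    ... | i , i<k , sameBlock , digits< =
      blockDigit i p , blockDigit-∈-digitRealiser k i p i<k p<n ,
      digit i (toℕ x) , digit i (toℕ y) ,
      blockDigit-inBlock i x ,
      trans (cong (λ q → blockDigit i q y) sameBlock) (blockDigit-inBlock i y) ,
      digits<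
      where
      p : ℕ
      p = dropDigits (suc i) (toℕ x)
      p<n : p < n
      p<n = ≤-<-trans (dropDigits-≤ (suc i) (toℕ x)) (Finₚ.toℕ<n x)

proposition2 : (t : ℕ) → 2 ≤ t → (n : ℕ) → 0 < n →
    (k : ℕ) → IsCeilLog t n k → LDim≡ (chain n) t k
proposition2 t 2≤t n _ k (n≤t^k , minimal) =
  (digitRealiser k , digitRealiser-isLocalRealiser k n≤t^k , μ-digitRealiser k) ,
  λ R isRealiser j μ≤j → minimal j (realiser⇒≤^ isRealiser μ≤j)
  where
  instance
    t≢0 : NonZero t
    t≢0 = >-nonZero (≤-trans (s≤s z≤n) 2≤t)
  open Digits t
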